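{- Let $x=(x_1,x_2,x_3)\in\mathbb{Z}^3$ satisfy $x_3^2-2x_2^2+x_1^2=2$. Then there exist a matrix $M\in H$ and a unique $\delta\in\Delta_2$ such that $x=M\delta$. Moreover, the matrix $M$ is unique with this property if $\delta\notin\{(1,0,1),(-1,0,-1)\}$, and it is unique up to right-multiplication by $J$ otherwise.
   Context: Vectors are viewed as column vectors. Let $B=\begin{pmatrix}3&4&0\\2&3&0\\0&0&1\end{pmatrix}$, $J=\begin{pmatrix}0&0&1\\0&1&0\\1&0&0\end{pmatrix}$, and let $H$ be the subgroup of $\mathrm{GL}_3(\mathbb{Z})$ generated by $B$ and $J$. Let $\Delta_2=\{(2,1,0),(-2,1,0),(1,0,1),(-1,0,1),(-1,0,-1)\}$. -}

module Defs where

open import Data.Integer using (ℤ; +_; -[1+_]; _+_; _*_; _-_; -_)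
open import Data.Vec using (Vec; []; _∷_)
open import Data.List using (List; []; _∷_)

-- Column vectors in ℤ³ and 3×3 integer matrices (list of rows).
Vec3 : Set
Vec3 = Vec ℤ 3

Mat3 : Set
Mat3 = Vec Vec3 3

vec : ℤ → ℤ → ℤ → Vec3
vec a b c = a ∷ b ∷ c ∷ []

mat : Vec3 → Vec3 → Vec3 → Mat3
mat r1 r2 r3 = r1 ∷ r2 ∷ r3 ∷ []

dot : Vec3 → Vec3 → ℤ
dot (a ∷ b ∷ c ∷ []) (d ∷ e ∷ f ∷ []) = a * d + b * e + c * f

_·_ : Mat3 → Vec3 → Vec3
(r1 ∷ r2 ∷ r3 ∷ []) · v = vec (dot r1 v) (dot r2 v) (dot r3 v)

col1 col2 col3 : Mat3 → Vec3
col1 ((a ∷ _ ∷ _ ∷ []) ∷ (b ∷ _ ∷ _ ∷ []) ∷ (c ∷ _ ∷ _ ∷ []) ∷ []) = vec a b c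
col2 ((_ ∷ a ∷ _ ∷ []) ∷ (_ ∷ b ∷ _ ∷ []) ∷ (_ ∷ c ∷ _ ∷ []) ∷ []) = vec a b c
col3 ((_ ∷ _ ∷ a ∷ []) ∷ (_ ∷ _ ∷ b ∷ []) ∷ (_ ∷ _ ∷ c ∷ []) ∷ []) = vec a b c

_⊗_ : Mat3 → Mat3 → Mat3
(r1 ∷ r2 ∷ r3 ∷ []) ⊗ N =
  mat (vec (dot r1 (col1 N)) (dot r1 (col2 N)) (dot r1 (col3 N)))
      (vec (dot r2 (col1 N)) (dot r2 (col2 N)) (dot r2 (col3 N)))
      (vec (dot r3 (col1 N)) (dot r3 (col2 N)) (dot r3 (col3 N)))

I₃ : Mat3
I₃ = mat (vec (+ 1) (+ 0) (+ 0)) (vec (+ 0) (+ 1) (+ 0)) (vec (+ 0) (+ 0) (+ 1))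

B : Mat3
B = mat (vec (+ 3) (+ 4) (+ 0)) (vec (+ 2) (+ 3) (+ 0)) (vec (+ 0) (+ 0) (+ 1))

B⁻¹ : Mat3
B⁻¹ = mat (vec (+ 3) (- (+ 4)) (+ 0)) (vec (- (+ 2)) (+ 3) (+ 0)) (vec (+ 0) (+ 0) (+ 1))

J : Mat3
J = mat (vec (+ 0) (+ 0) (+ 1)) (vec (+ 0) (+ 1) (+ 0)) (vec (+ 1) (+ 0) (+ 0))

-- H = subgroup of GL₃(ℤ) generated by B and J: all finite words in
-- B, B⁻¹, J (= J⁻¹).
data InH : Mat3 → Set where
  h-id  : InH I₃
  h-B   : ∀ {M} → InH M → InH (M ⊗ B)
  h-B⁻¹ : ∀ {M} → InH M → InH (M ⊗ B⁻¹)
  h-J   : ∀ {M} → InH M → InH (M ⊗ J)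

Δ₂ : List Vec3
Δ₂ = vec (+ 2) (+ 1) (+ 0)
   ∷ vec (- (+ 2)) (+ 1) (+ 0)
   ∷ vec (+ 1) (+ 0) (+ 1)
   ∷ vec (- (+ 1)) (+ 0) (+ 1)
   ∷ vec (- (+ 1)) (+ 0) (- (+ 1))
   ∷ []

Special : List Vec3
Special = vec (+ 1) (+ 0) (+ 1) ∷ vec (- (+ 1)) (+ 0) (- (+ 1)) ∷ []

module Submission where

open import Defs
open import Data.Integer using (ℤ; +_; _+_; _*_; _-_)
open import Data.Vec using (Vec; []; _∷_)
open import Data.List.Membership.Propositional using (_∈_; _∉_)
open import Data.Product using (Σ; _×_; _,_)
open import Data.Sum using (_⊎_)
open import Relation.Binary.PropositionalEquality using (_≡_)

open import Data.Integer using (-_; -[1+_]; ∣_∣; _⊖_; _≤ᵇ_)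
open import Data.Integer.Properties
  using (_≟_; ∣i+j∣≤∣i∣+∣j∣; abs-*; ∣-i∣≡∣i∣; ∣i∣≡0⇒i≡0; [+m]-[+n]≡m⊖n; ⊖-≥; ∣⊖∣-<; pos-*; pos-+; +-injective)
open import Data.Integer.Tactic.RingSolver using (solve-∀)
open import Data.Nat using (ℕ; zero; suc; _≤_; _<_; _<ᵇ_; _<?_; z≤n; s≤s; z<s)
  renaming (_+_ to _+ₙ_; _*_ to _*ₙ_)
open import Data.Nat.Properties
  using ( ≤-reflexive; ≤-trans; <-irrefl; <-asym; ≤-<-connex; m≤n⇒m<n∨m≡n; <⇒≱; ≰⇒>; ≮⇒≥; n<1+n; n≤0⇒n≡0
        ; m≤m+n; m<m+n; m<n+m; +-comm; +-identityʳ; +-suc; suc-injective; *-distribˡ-+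
        ; +-cancelˡ-≡; +-cancelˡ-≤; *-cancelˡ-≤; +-mono-≤; +-monoˡ-≤; +-monoʳ-≤; +-monoˡ-<; +-monoʳ-<
        ; *-mono-≤; *-monoʳ-≤; *-monoʳ-<; m<n+o⇒m∸n<o; <⇒<ᵇ; <ᵇ⇒<; module ≤-Reasoning )
import Data.Nat.Tactic.RingSolver as ℕ-Solver
open import Data.Nat.Induction using (<-wellFounded)
open import Induction.WellFounded using (Acc; acc)
open import Data.Bool using (true; false; T)
open import Data.Unit using (tt)
open import Data.Empty using (⊥; ⊥-elim)
open import Data.List using (List; []; _∷_; _++_)
open import Data.List.Relation.Unary.Any using (here; there)
open import Data.List.Relation.Unary.All as All using (All; all?)
import Data.Vec.Properties
open import Data.List.Membership.DecPropositional (Data.Vec.Properties.≡-dec {n = 3} _≟_) using (_∈?_)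
open import Data.Product using (proj₁; proj₂)
open import Data.Sum using (inj₁; inj₂)
open import Relation.Nullary using (¬_; Dec; yes; no; ¬?)
open import Relation.Nullary.Decidable using (from-yes; _×-dec_; _⊎-dec_; _→-dec_)
open import Relation.Binary.PropositionalEquality
  using (_≢_; refl; sym; trans; cong; cong₂; subst; module ≡-Reasoning)

-- H acts on the quadric Q(x) = x₃² - 2x₂² + x₁² = 2, and we measure a point
-- (a, b, c) by the height h = 6|b| + 2·(rank of (a, c)) + (sign of b), where the rank is 0, 1
-- or 2 according to how |a| compares with |c| (ties broken by a ≤ c).  Two facts about
-- the generators B, B⁻¹, J drive everything, both reduced to arithmetic on the norm equation
-- |a|² + |c|² = 2 + 2|b|²:
--   * ping-pong: of two distinct generators, at least one raises the height;
--   * a point where no generator lowers the height is one of the five roots Δ₂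
--     (the inequalities confine it to a small box, which is checked exhaustively).
-- Existence follows by descent on h.  For uniqueness, two expressions M δ = M' δ' give a
-- reduced word carrying the root δ to the root δ'; by ping-pong the heights along a reduced
-- word starting upwards keep increasing, so it ends at a non-root unless the word is empty
-- or the single letter J fixing one of the two J-symmetric roots (1,0,1), (-1,0,-1).

cong₃ : ∀ {A B C D : Set} (f : A → B → C → D) {x x' y y' z z'} →
        x ≡ x' → y ≡ y' → z ≡ z' → f x y z ≡ f x' y' z'
cong₃ f refl refl refl = refl

dot-assoc : ∀ a b c p q r s t u k l m x y z →
  (a * p + b * s + c * k) * x + (a * q + b * t + c * l) * y + (a * r + b * u + c * m) * z
  ≡ a * (p * x + q * y + r * z) + b * (s * x + t * y + u * z) + c * (k * x + l * y + m * z)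
dot-assoc = solve-∀

row-⊗-· : ∀ (ρ : Vec3) N v →
  dot (vec (dot ρ (col1 N)) (dot ρ (col2 N)) (dot ρ (col3 N))) v ≡ dot ρ (N · v)
row-⊗-· (a ∷ b ∷ c ∷ []) ((p ∷ q ∷ r ∷ []) ∷ (s ∷ t ∷ u ∷ []) ∷ (k ∷ l ∷ m ∷ []) ∷ []) (x ∷ y ∷ z ∷ []) =
  dot-assoc a b c p q r s t u k l m x y z

⊗-· : ∀ M N v → (M ⊗ N) · v ≡ M · (N · v)
⊗-· (ρ₁ ∷ ρ₂ ∷ ρ₃ ∷ []) N v = cong₃ vec (row-⊗-· ρ₁ N v) (row-⊗-· ρ₂ N v) (row-⊗-· ρ₃ N v)

e₁-dot : ∀ x y z → + 1 * x + + 0 * y + + 0 * z ≡ x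
e₁-dot = solve-∀

e₂-dot : ∀ x y z → + 0 * x + + 1 * y + + 0 * z ≡ y
e₂-dot = solve-∀

e₃-dot : ∀ x y z → + 0 * x + + 0 * y + + 1 * z ≡ z
e₃-dot = solve-∀

I₃-· : ∀ v → I₃ · v ≡ v
I₃-· (x ∷ y ∷ z ∷ []) = cong₃ vec (e₁-dot x y z) (e₂-dot x y z) (e₃-dot x y z)

J-· : ∀ x y z → J · vec x y z ≡ vec z y x
J-· x y z = cong₃ vec (e₃-dot x y z) (e₂-dot x y z) (e₁-dot x y z)

e₁ e₂ e₃ : Vec3
e₁ = vec (+ 1) (+ 0) (+ 0)
e₂ = vec (+ 0) (+ 1) (+ 0)
e₃ = vec (+ 0) (+ 0) (+ 1)

dot-e₁ : ∀ a b c → a * + 1 + b * + 0 + c * + 0 ≡ a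
dot-e₁ = solve-∀

dot-e₂ : ∀ a b c → a * + 0 + b * + 1 + c * + 0 ≡ b
dot-e₂ = solve-∀

dot-e₃ : ∀ a b c → a * + 0 + b * + 0 + c * + 1 ≡ c
dot-e₃ = solve-∀

fromColumns : Vec3 → Vec3 → Vec3 → Mat3
fromColumns (a₁ ∷ a₂ ∷ a₃ ∷ []) (b₁ ∷ b₂ ∷ b₃ ∷ []) (c₁ ∷ c₂ ∷ c₃ ∷ []) =
  mat (vec a₁ b₁ c₁) (vec a₂ b₂ c₂) (vec a₃ b₃ c₃)

columns : ∀ M → fromColumns (M · e₁) (M · e₂) (M · e₃) ≡ M
columns (ρ₁ ∷ ρ₂ ∷ ρ₃ ∷ []) = cong₃ mat (row ρ₁) (row ρ₂) (row ρ₃)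
  where
  row : ∀ ρ → vec (dot ρ e₁) (dot ρ e₂) (dot ρ e₃) ≡ ρ
  row (a ∷ b ∷ c ∷ []) = cong₃ vec (dot-e₁ a b c) (dot-e₂ a b c) (dot-e₃ a b c)

·-injective : ∀ M N → (∀ v → M · v ≡ N · v) → M ≡ N
·-injective M N same = begin
  M                                        ≡⟨ columns M ⟨
  fromColumns (M · e₁) (M · e₂) (M · e₃)   ≡⟨ cong₃ fromColumns (same e₁) (same e₂) (same e₃) ⟩
  fromColumns (N · e₁) (N · e₂) (N · e₃)   ≡⟨ columns N ⟩
  N                                        ∎
  where open ≡-Reasoning

data Gen : Set where
  gB gB⁻¹ gJ : Gen

⟦_⟧ : Gen → Mat3
⟦ gB ⟧   = B
⟦ gB⁻¹ ⟧ = B⁻¹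
⟦ gJ ⟧   = J

inv : Gen → Gen
inv gB   = gB⁻¹
inv gB⁻¹ = gB
inv gJ   = gJ

inv-involutive : ∀ g → inv (inv g) ≡ g
inv-involutive gB   = refl
inv-involutive gB⁻¹ = refl
inv-involutive gJ   = refl

_≟ᵍ_ : (g g' : Gen) → Dec (g ≡ g')
gB   ≟ᵍ gB   = yes refl
gB   ≟ᵍ gB⁻¹ = no λ ()
gB   ≟ᵍ gJ   = no λ ()
gB⁻¹ ≟ᵍ gB   = no λ ()
gB⁻¹ ≟ᵍ gB⁻¹ = yes refl
gB⁻¹ ≟ᵍ gJ   = no λ ()
gJ   ≟ᵍ gB   = no λ ()
gJ   ≟ᵍ gB⁻¹ = no λ ()
gJ   ≟ᵍ gJ   = yes refl

inv-⊗ : ∀ g → ⟦ inv g ⟧ ⊗ ⟦ g ⟧ ≡ I₃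
inv-⊗ gB   = refl
inv-⊗ gB⁻¹ = refl
inv-⊗ gJ   = refl

cancelˡ : ∀ g v → ⟦ inv g ⟧ · (⟦ g ⟧ · v) ≡ v
cancelˡ g v = begin
  ⟦ inv g ⟧ · (⟦ g ⟧ · v)  ≡⟨ ⊗-· ⟦ inv g ⟧ ⟦ g ⟧ v ⟨
  (⟦ inv g ⟧ ⊗ ⟦ g ⟧) · v  ≡⟨ cong (_· v) (inv-⊗ g) ⟩
  I₃ · v                   ≡⟨ I₃-· v ⟩
  v                        ∎
  where open ≡-Reasoning

cancelʳ : ∀ g v → ⟦ g ⟧ · (⟦ inv g ⟧ · v) ≡ v
cancelʳ g v = subst (λ k → ⟦ k ⟧ · (⟦ inv g ⟧ · v) ≡ v) (inv-involutive g) (cancelˡ (inv g) v)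

Q : Vec3 → ℤ
Q (x ∷ y ∷ z ∷ []) = z * z - + 2 * (y * y) + x * x

-- B preserves Q: (3x + 4y)² - 2(2x + 3y)² = x² - 2y².
B-preserves-Q : ∀ x y z →
  (+ 0 * x + + 0 * y + + 1 * z) * (+ 0 * x + + 0 * y + + 1 * z)
    - + 2 * ((+ 2 * x + + 3 * y + + 0 * z) * (+ 2 * x + + 3 * y + + 0 * z))
    + (+ 3 * x + + 4 * y + + 0 * z) * (+ 3 * x + + 4 * y + + 0 * z)
  ≡ z * z - + 2 * (y * y) + x * x
B-preserves-Q = solve-∀

J-preserves-Q : ∀ x y z → x * x - + 2 * (y * y) + z * z ≡ z * z - + 2 * (y * y) + x * x
J-preserves-Q = solve-∀

Q-invariant : ∀ g v → Q (⟦ g ⟧ · v) ≡ Q v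
Q-invariant gB   (x ∷ y ∷ z ∷ []) = B-preserves-Q x y z
Q-invariant gB⁻¹ v                = trans (sym (Q-invariant gB (B⁻¹ · v))) (cong Q (cancelʳ gB v))
Q-invariant gJ   (x ∷ y ∷ z ∷ []) = trans (cong Q (J-· x y z)) (J-preserves-Q x y z)

-- The middle coordinate of B · (a, b, c) is ν a b, that of B⁻¹ · (a, b, c) is ν (-a) b
-- (the left-hand sides below are these middle coordinates unfolded).
ν : ℤ → ℤ → ℤ
ν a b = + 2 * a + + 3 * b

middle : Vec3 → ℤ
middle (_ ∷ y ∷ _ ∷ []) = y

B-middle : ∀ a b c → + 2 * a + + 3 * b + + 0 * c ≡ + 2 * a + + 3 * b
B-middle = solve-∀

B⁻¹-middle : ∀ a b c → - (+ 2) * a + + 3 * b + + 0 * c ≡ + 2 * (- a) + + 3 * b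
B⁻¹-middle = solve-∀

-- Words in the generators; a word acts letter by letter, first letter first.
Word : Set
Word = List Gen

act : Word → Vec3 → Vec3
act []      v = v
act (g ∷ w) v = act w (⟦ g ⟧ · v)

eval : Word → Mat3
eval []      = I₃
eval (g ∷ w) = eval w ⊗ ⟦ g ⟧

eval-· : ∀ w v → eval w · v ≡ act w v
eval-· []      v = I₃-· v
eval-· (g ∷ w) v = trans (⊗-· (eval w) ⟦ g ⟧ v) (eval-· w (⟦ g ⟧ · v))

eval-InH : ∀ w → InH (eval w)
eval-InH []         = h-id
eval-InH (gB ∷ w)   = h-B (eval-InH w)
eval-InH (gB⁻¹ ∷ w) = h-B⁻¹ (eval-InH w)
eval-InH (gJ ∷ w)   = h-J (eval-InH w)

InH-eval : ∀ {M} → InH M → Σ Word λ w → M ≡ eval w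
InH-eval h-id = [] , refl
InH-eval (h-B p) with InH-eval p
... | w , refl = gB ∷ w , refl
InH-eval (h-B⁻¹ p) with InH-eval p
... | w , refl = gB⁻¹ ∷ w , refl
InH-eval (h-J p) with InH-eval p
... | w , refl = gJ ∷ w , refl

act-++ : ∀ w u v → act (w ++ u) v ≡ act u (act w v)
act-++ []      u v = refl
act-++ (g ∷ w) u v = act-++ w u (⟦ g ⟧ · v)

inverse : Word → Word
inverse []      = []
inverse (g ∷ w) = inverse w ++ (inv g ∷ [])

inverse-actˡ : ∀ w v → act (inverse w) (act w v) ≡ v
inverse-actˡ []      v = refl
inverse-actˡ (g ∷ w) v = begin
  act (inverse w ++ (inv g ∷ [])) (act w (⟦ g ⟧ · v))  ≡⟨ act-++ (inverse w) (inv g ∷ []) (act w (⟦ g ⟧ · v)) ⟩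
  ⟦ inv g ⟧ · act (inverse w) (act w (⟦ g ⟧ · v))     ≡⟨ cong (⟦ inv g ⟧ ·_) (inverse-actˡ w (⟦ g ⟧ · v)) ⟩
  ⟦ inv g ⟧ · (⟦ g ⟧ · v)                             ≡⟨ cancelˡ g v ⟩
  v                                                   ∎
  where open ≡-Reasoning

inverse-actʳ : ∀ w v → act w (act (inverse w) v) ≡ v
inverse-actʳ []      v = refl
inverse-actʳ (g ∷ w) v = begin
  act w (⟦ g ⟧ · act (inverse w ++ (inv g ∷ [])) v)  ≡⟨ cong (λ t → act w (⟦ g ⟧ · t)) (act-++ (inverse w) (inv g ∷ []) v) ⟩
  act w (⟦ g ⟧ · (⟦ inv g ⟧ · act (inverse w) v))   ≡⟨ cong (act w) (cancelʳ g (act (inverse w) v)) ⟩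
  act w (act (inverse w) v)                         ≡⟨ inverse-actʳ w v ⟩
  v                                                 ∎
  where open ≡-Reasoning

-- Reduced words.  ReducedAfter c w: w is reduced and does not start with inv c.
data ReducedAfter : Gen → Word → Set where
  []  : ∀ {c} → ReducedAfter c []
  _∷_ : ∀ {c g w} → g ≢ inv c → ReducedAfter g w → ReducedAfter c (g ∷ w)

data Reduced : Word → Set where
  []  : Reduced []
  _∷_ : ∀ g {w} → ReducedAfter g w → Reduced (g ∷ w)

ReducedAfter⇒Reduced : ∀ {c w} → ReducedAfter c w → Reduced w
ReducedAfter⇒Reduced []                 = []
ReducedAfter⇒Reduced (_∷_ {g = g} _ rw) = g ∷ rw

push : Gen → Word → Word
push g []       = g ∷ []
push g (g' ∷ w) with g' ≟ᵍ inv g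
... | yes _ = w
... | no  _ = g ∷ g' ∷ w

push-act : ∀ g w v → act (push g w) v ≡ act w (⟦ g ⟧ · v)
push-act g []       v = refl
push-act g (g' ∷ w) v with g' ≟ᵍ inv g
... | yes refl = cong (act w) (sym (cancelˡ g v))
... | no  _    = refl

push-reduced : ∀ g w → Reduced w → Reduced (push g w)
push-reduced g []       _          = g ∷ []
push-reduced g (g' ∷ w) (.g' ∷ rw) with g' ≟ᵍ inv g
... | yes _ = ReducedAfter⇒Reduced rw
... | no ne = g ∷ (ne ∷ rw)

reduce : Word → Word
reduce []      = []
reduce (g ∷ w) = push g (reduce w)

reduce-act : ∀ w v → act (reduce w) v ≡ act w v
reduce-act []      v = refl
reduce-act (g ∷ w) v = trans (push-act g (reduce w) v) (reduce-act w (⟦ g ⟧ · v))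

reduce-reduced : ∀ w → Reduced (reduce w)
reduce-reduced []      = []
reduce-reduced (g ∷ w) = push-reduced g (reduce w) (reduce-reduced w)

sq-mono : ∀ {m n} → m ≤ n → m *ₙ m ≤ n *ₙ n
sq-mono m≤n = *-mono-≤ m≤n m≤n

double≢1 : ∀ n → n +ₙ n ≢ 1
double≢1 zero    ()
double≢1 (suc n) eq with trans (sym (+-suc (suc n) n)) eq
... | ()

-- Two squares never differ by 2: m ≤ n is too small, m = n + 1 has the wrong parity,
-- and m ≥ n + 2 is too large.
squares-differ-by-two : ∀ m n → m *ₙ m ≢ 2 +ₙ n *ₙ n
squares-differ-by-two m n eq with ≤-<-connex m n
... | inj₁ m≤n = <⇒≱ (begin-strict
  m *ₙ m        ≤⟨ sq-mono m≤n ⟩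
  n *ₙ n        <⟨ m<n+m (n *ₙ n) z<s ⟩
  2 +ₙ n *ₙ n   ∎) (≤-reflexive (sym eq))
  where open ≤-Reasoning
... | inj₂ n<m with m≤n⇒m<n∨m≡n n<m
...   | inj₂ refl = double≢1 n (+-cancelˡ-≡ (n *ₙ n) (n +ₙ n) 1
                      (trans (suc-injective (trans (sym (sq-suc n)) eq)) (+-comm 1 (n *ₙ n))))
  where
  sq-suc : ∀ n → suc n *ₙ suc n ≡ suc (n *ₙ n +ₙ (n +ₙ n))
  sq-suc = ℕ-Solver.solve-∀
...   | inj₁ 1+n<m = <⇒≱ (begin-strict
  2 +ₙ n *ₙ n                       <⟨ m<m+n (2 +ₙ n *ₙ n) z<s ⟩
  (2 +ₙ n *ₙ n) +ₙ (2 +ₙ 4 *ₙ n)    ≡⟨ sq-suc-suc n ⟩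
  suc (suc n) *ₙ suc (suc n)        ≤⟨ sq-mono 1+n<m ⟩
  m *ₙ m                            ∎) (≤-reflexive eq)
  where
  open ≤-Reasoning
  sq-suc-suc : ∀ n → (2 +ₙ n *ₙ n) +ₙ (2 +ₙ 4 *ₙ n) ≡ suc (suc n) *ₙ suc (suc n)
  sq-suc-suc = ℕ-Solver.solve-∀

-- The norm equation satisfied by the absolute values A, β, C of the coordinates of a
-- point (a, b, c) of the quadric Q = 2 (see norm-equation below).
record NormEq (A β C : ℕ) : Set where
  constructor normEq
  field equation : A *ₙ A +ₙ C *ₙ C ≡ 2 +ₙ 2 *ₙ (β *ₙ β)

-- The norm equation has no solution with β ≤ A ≤ C in which β = 0 forces A = 0:
-- for β = A it would give C² = 2 + β², and for β < A it forces β = 0.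
no-double-stall : ∀ {A β C} → NormEq A β C → A ≤ C → β ≤ A → (β ≡ 0 → A ≡ 0) → ⊥
no-double-stall {A} {β} {C} (normEq eq) A≤C β≤A β≡0⇒A≡0 with m≤n⇒m<n∨m≡n β≤A
... | inj₂ refl = squares-differ-by-two C β (+-cancelˡ-≡ (β *ₙ β) (C *ₙ C) (2 +ₙ β *ₙ β) (trans eq (split β)))
  where
  split : ∀ β → 2 +ₙ 2 *ₙ (β *ₙ β) ≡ β *ₙ β +ₙ (2 +ₙ β *ₙ β)
  split = ℕ-Solver.solve-∀
... | inj₁ β<A = <-irrefl (trans β≡0 (sym (β≡0⇒A≡0 β≡0))) β<A
  where
  open ≤-Reasoning
  A²≤1+β² : A *ₙ A ≤ 1 +ₙ β *ₙ β
  A²≤1+β² = *-cancelˡ-≤ 2 (begin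
    2 *ₙ (A *ₙ A)         ≡⟨ double (A *ₙ A) ⟩
    A *ₙ A +ₙ A *ₙ A      ≤⟨ +-monoʳ-≤ (A *ₙ A) (sq-mono A≤C) ⟩
    A *ₙ A +ₙ C *ₙ C      ≡⟨ eq ⟩
    2 +ₙ 2 *ₙ (β *ₙ β)    ≡⟨ *-distribˡ-+ 2 1 (β *ₙ β) ⟨
    2 *ₙ (1 +ₙ β *ₙ β)    ∎)
    where
    double : ∀ n → 2 *ₙ n ≡ n +ₙ n
    double = ℕ-Solver.solve-∀
  β≡0 : β ≡ 0
  β≡0 = n≤0⇒n≡0 (*-cancelˡ-≤ 2 (+-cancelˡ-≤ (1 +ₙ β *ₙ β) (2 *ₙ β) 0 (begin
    (1 +ₙ β *ₙ β) +ₙ 2 *ₙ β   ≡⟨ sq-suc β ⟩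
    suc β *ₙ suc β            ≤⟨ sq-mono β<A ⟩
    A *ₙ A                    ≤⟨ A²≤1+β² ⟩
    1 +ₙ β *ₙ β               ≡⟨ +-identityʳ (1 +ₙ β *ₙ β) ⟨
    (1 +ₙ β *ₙ β) +ₙ 0        ∎)))
    where
    sq-suc : ∀ n → (1 +ₙ n *ₙ n) +ₙ 2 *ₙ n ≡ suc n *ₙ suc n
    sq-suc = ℕ-Solver.solve-∀

between : ∀ {A β C} → NormEq A β C → C ≤ A → 2 ≤ β → β < A × A < 2 *ₙ β
between {A} {β} {C} (normEq eq) C≤A 2≤β = ≰⇒> A≰β , ≰⇒> 2β≰A
  where
  open ≤-Reasoning
  A≰β : ¬ (A ≤ β)
  A≰β A≤β = <⇒≱ (begin-strict
    A *ₙ A +ₙ C *ₙ C      ≤⟨ +-mono-≤ (sq-mono A≤β) (sq-mono (≤-trans C≤A A≤β)) ⟩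
    β *ₙ β +ₙ β *ₙ β      ≡⟨ double (β *ₙ β) ⟩
    2 *ₙ (β *ₙ β)         <⟨ m<n+m (2 *ₙ (β *ₙ β)) {2} z<s ⟩
    2 +ₙ 2 *ₙ (β *ₙ β)    ∎) (≤-reflexive (sym eq))
    where
    double : ∀ n → n +ₙ n ≡ 2 *ₙ n
    double = ℕ-Solver.solve-∀
  2β≰A : ¬ (2 *ₙ β ≤ A)
  2β≰A 2β≤A = <⇒≱ (begin-strict
    2 +ₙ 2 *ₙ (β *ₙ β)               <⟨ +-monoˡ-< (2 *ₙ (β *ₙ β)) 2<2β² ⟩
    2 *ₙ (β *ₙ β) +ₙ 2 *ₙ (β *ₙ β)   ≡⟨ quadruple β ⟩
    (2 *ₙ β) *ₙ (2 *ₙ β)             ≤⟨ sq-mono 2β≤A ⟩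
    A *ₙ A                           ≤⟨ m≤m+n (A *ₙ A) (C *ₙ C) ⟩
    A *ₙ A +ₙ C *ₙ C                 ∎) (≤-reflexive eq)
    where
    quadruple : ∀ n → 2 *ₙ (n *ₙ n) +ₙ 2 *ₙ (n *ₙ n) ≡ (2 *ₙ n) *ₙ (2 *ₙ n)
    quadruple = ℕ-Solver.solve-∀
    2<2β² : 2 < 2 *ₙ (β *ₙ β)
    2<2β² = ≤-trans (s≤s (s≤s (s≤s (z≤n {5})))) (*-monoʳ-≤ 2 (sq-mono 2≤β))

outer-bound : ∀ {A β C} → NormEq A β C → β ≤ 1 → A ≤ 2
outer-bound {A} {β} {C} (normEq eq) β≤1 = ≮⇒≥ λ 2<A → <⇒≱ (begin-strict
  2 +ₙ 2 *ₙ (β *ₙ β)   ≤⟨ +-monoʳ-≤ 2 (*-monoʳ-≤ 2 (sq-mono β≤1)) ⟩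
  4                    <⟨ s≤s (s≤s (s≤s (s≤s (s≤s z≤n)))) ⟩
  3 *ₙ 3               ≤⟨ sq-mono 2<A ⟩
  A *ₙ A               ≤⟨ m≤m+n (A *ₙ A) (C *ₙ C) ⟩
  A *ₙ A +ₙ C *ₙ C     ∎) (≤-reflexive eq)
  where open ≤-Reasoning

-- If B does not make the middle coordinate larger in absolute value, then |b| ≤ |a|,
-- and a = 0 when b = 0 (from 3b = ν a b - 2a).
stall-bound : ∀ a b → ∣ ν a b ∣ ≤ ∣ b ∣ → ∣ b ∣ ≤ ∣ a ∣ × (∣ b ∣ ≡ 0 → ∣ a ∣ ≡ 0)
stall-bound a b ν≤b = *-cancelˡ-≤ 2 (+-cancelˡ-≤ ∣ b ∣ (2 *ₙ ∣ b ∣) (2 *ₙ ∣ a ∣) (begin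
    ∣ b ∣ +ₙ 2 *ₙ ∣ b ∣             ≡⟨ triple ∣ b ∣ ⟩
    3 *ₙ ∣ b ∣                      ≡⟨ abs-* (+ 3) b ⟨
    ∣ + 3 * b ∣                     ≡⟨ cong ∣_∣ (three-b a b) ⟩
    ∣ ν a b + - (+ 2 * a) ∣         ≤⟨ ∣i+j∣≤∣i∣+∣j∣ (ν a b) (- (+ 2 * a)) ⟩
    ∣ ν a b ∣ +ₙ ∣ - (+ 2 * a) ∣    ≡⟨ cong (∣ ν a b ∣ +ₙ_) (trans (∣-i∣≡∣i∣ (+ 2 * a)) (abs-* (+ 2) a)) ⟩
    ∣ ν a b ∣ +ₙ 2 *ₙ ∣ a ∣         ≤⟨ +-monoˡ-≤ (2 *ₙ ∣ a ∣) ν≤b ⟩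
    ∣ b ∣ +ₙ 2 *ₙ ∣ a ∣             ∎))
  , b≡0⇒a≡0
  where
  open ≤-Reasoning
  triple : ∀ n → n +ₙ 2 *ₙ n ≡ 3 *ₙ n
  triple = ℕ-Solver.solve-∀
  three-b : ∀ a b → + 3 * b ≡ (+ 2 * a + + 3 * b) + - (+ 2 * a)
  three-b = solve-∀
  ν-at-0 : ∀ a → + 2 * a + + 3 * + 0 ≡ + 2 * a
  ν-at-0 = solve-∀
  b≡0⇒a≡0 : ∣ b ∣ ≡ 0 → ∣ a ∣ ≡ 0
  b≡0⇒a≡0 ∣b∣≡0 = n≤0⇒n≡0 (*-cancelˡ-≤ 2 (subst (_≤ 0) (trans (cong ∣_∣ (ν-at-0 a)) (abs-* (+ 2) a))
                    (subst (λ t → ∣ ν a t ∣ ≤ ∣ t ∣) (∣i∣≡0⇒i≡0 ∣b∣≡0) ν≤b)))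

-- B and B⁻¹ cannot both keep the middle coordinate from growing unless it is 0
-- (from 6b = ν a b + ν (-a) b).
two-sided-stall : ∀ a b → ∣ ν a b ∣ ≤ ∣ b ∣ → ∣ ν (- a) b ∣ ≤ ∣ b ∣ → ∣ b ∣ ≡ 0
two-sided-stall a b ν≤b ν'≤b = six-le-two ∣ b ∣ (begin
  6 *ₙ ∣ b ∣                     ≡⟨ abs-* (+ 6) b ⟨
  ∣ + 6 * b ∣                    ≡⟨ cong ∣_∣ (six-b a b) ⟩
  ∣ ν a b + ν (- a) b ∣          ≤⟨ ∣i+j∣≤∣i∣+∣j∣ (ν a b) (ν (- a) b) ⟩
  ∣ ν a b ∣ +ₙ ∣ ν (- a) b ∣     ≤⟨ +-mono-≤ ν≤b ν'≤b ⟩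
  ∣ b ∣ +ₙ ∣ b ∣                 ∎)
  where
  open ≤-Reasoning
  six-b : ∀ a b → + 6 * b ≡ (+ 2 * a + + 3 * b) + (+ 2 * (- a) + + 3 * b)
  six-b = solve-∀
  six-le-two : ∀ n → 6 *ₙ n ≤ n +ₙ n → n ≡ 0
  six-le-two n le = n≤0⇒n≡0 (*-cancelˡ-≤ 4 (+-cancelˡ-≤ (n +ₙ n) (4 *ₙ n) 0 (begin
    (n +ₙ n) +ₙ 4 *ₙ n   ≡⟨ split n ⟩
    6 *ₙ n               ≤⟨ le ⟩
    n +ₙ n               ≡⟨ +-identityʳ (n +ₙ n) ⟨
    (n +ₙ n) +ₙ 0        ∎)))
    where
    split : ∀ n → (n +ₙ n) +ₙ 4 *ₙ n ≡ 6 *ₙ n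
    split = ℕ-Solver.solve-∀

shrink-bound : ∀ A β → β < A → A < 2 *ₙ β → ∣ + 3 * + β - + 2 * + A ∣ < β
shrink-bound A zero      _   ()
shrink-bound A β@(suc _) β<A A<2β = subst (_< β) (sym (cong ∣_∣ as-⊖)) (by-sign (≤-<-connex (2 *ₙ A) (3 *ₙ β)))
  where
  open ≤-Reasoning
  as-⊖ : + 3 * + β - + 2 * + A ≡ (3 *ₙ β) ⊖ (2 *ₙ A)
  as-⊖ = trans (cong₂ _-_ (sym (pos-* 3 β)) (sym (pos-* 2 A))) ([+m]-[+n]≡m⊖n (3 *ₙ β) (2 *ₙ A))
  three : ∀ n → 3 *ₙ n ≡ n +ₙ 2 *ₙ n
  three = ℕ-Solver.solve-∀
  four : ∀ n → 2 *ₙ (2 *ₙ n) ≡ 3 *ₙ n +ₙ n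
  four = ℕ-Solver.solve-∀
  by-sign : 2 *ₙ A ≤ 3 *ₙ β ⊎ 3 *ₙ β < 2 *ₙ A → ∣ (3 *ₙ β) ⊖ (2 *ₙ A) ∣ < β
  by-sign (inj₁ 2A≤3β) = subst (_< β) (sym (cong ∣_∣ (⊖-≥ 2A≤3β))) (m<n+o⇒m∸n<o (3 *ₙ β) (2 *ₙ A) (begin-strict
    3 *ₙ β           ≡⟨ three β ⟩
    β +ₙ 2 *ₙ β      <⟨ +-monoʳ-< β (*-monoʳ-< 2 β<A) ⟩
    β +ₙ 2 *ₙ A      ≡⟨ +-comm β (2 *ₙ A) ⟩
    2 *ₙ A +ₙ β      ∎))
  by-sign (inj₂ 3β<2A) = subst (_< β) (sym (∣⊖∣-< 3β<2A)) (m<n+o⇒m∸n<o (2 *ₙ A) (3 *ₙ β) (begin-strict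
    2 *ₙ A           <⟨ *-monoʳ-< 2 A<2β ⟩
    2 *ₙ (2 *ₙ β)    ≡⟨ four β ⟩
    3 *ₙ β +ₙ β      ∎))

same-sign : ∀ x y → + 2 * (- x) + + 3 * y ≡ + 3 * y - + 2 * x
same-sign = solve-∀

opposite-sign : ∀ x y → + 2 * x + + 3 * (- y) ≡ - (+ 3 * y - + 2 * x)
opposite-sign = solve-∀

ν-abs : ∀ a b → ∣ ν a b ∣ ≡ ∣ + 3 * + ∣ b ∣ - + 2 * + ∣ a ∣ ∣ ⊎ ∣ ν (- a) b ∣ ≡ ∣ + 3 * + ∣ b ∣ - + 2 * + ∣ a ∣ ∣
ν-abs (+ m)     (+ n)     = inj₂ (cong ∣_∣ (same-sign (+ m) (+ n)))
ν-abs (+ m)     -[1+ n ]  = inj₁ (trans (cong ∣_∣ (opposite-sign (+ m) (+ suc n))) (∣-i∣≡∣i∣ (+ 3 * + suc n - + 2 * + m)))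
ν-abs -[1+ m ]  (+ n)     = inj₁ (cong ∣_∣ (same-sign (+ suc m) (+ n)))
ν-abs -[1+ m ]  -[1+ n ]  = inj₂ (trans (cong ∣_∣ (opposite-sign (+ suc m) (+ suc n))) (∣-i∣≡∣i∣ (+ 3 * + suc n - + 2 * + suc m)))

descent-step : ∀ a b → ∣ b ∣ < ∣ a ∣ → ∣ a ∣ < 2 *ₙ ∣ b ∣ → ∣ ν a b ∣ < ∣ b ∣ ⊎ ∣ ν (- a) b ∣ < ∣ b ∣
descent-step a b b<a a<2b with ν-abs a b
... | inj₁ eq = inj₁ (subst (_< ∣ b ∣) (sym eq) (shrink-bound ∣ a ∣ ∣ b ∣ b<a a<2b))
... | inj₂ eq = inj₂ (subst (_< ∣ b ∣) (sym eq) (shrink-bound ∣ a ∣ ∣ b ∣ b<a a<2b))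

outerRank : ℤ → ℤ → ℕ
outerRank a c with ∣ c ∣ <ᵇ ∣ a ∣ | ∣ a ∣ <ᵇ ∣ c ∣ | a ≤ᵇ c
... | true  | _     | _     = 0
... | false | true  | _     = 2
... | false | false | true  = 1
... | false | false | false = 2

signRank : ℤ → ℕ
signRank (+ _)    = 0
signRank -[1+ _ ] = 1

-- The height of a point: |b| first, then the outer rank, then the sign of b.
h : Vec3 → ℕ
h (a ∷ b ∷ c ∷ []) = 6 *ₙ ∣ b ∣ +ₙ (2 *ₙ outerRank a c +ₙ signRank b)

Raises Lowers : Gen → Vec3 → Set
Raises g y = h y < h (⟦ g ⟧ · y)
Lowers g y = h (⟦ g ⟧ · y) < h y

outerRank≤2 : ∀ a c → outerRank a c ≤ 2
outerRank≤2 a c with ∣ c ∣ <ᵇ ∣ a ∣ | ∣ a ∣ <ᵇ ∣ c ∣ | a ≤ᵇ c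
... | true  | _     | _     = z≤n
... | false | true  | _     = s≤s (s≤s z≤n)
... | false | false | true  = s≤s z≤n
... | false | false | false = s≤s (s≤s z≤n)

signRank≤1 : ∀ b → signRank b ≤ 1
signRank≤1 (+ _)    = z≤n
signRank≤1 -[1+ _ ] = s≤s z≤n

h-middle : ∀ y y' → ∣ middle y ∣ < ∣ middle y' ∣ → h y < h y'
h-middle (a ∷ b ∷ c ∷ []) (a' ∷ b' ∷ c' ∷ []) b<b' = begin-strict
  6 *ₙ ∣ b ∣ +ₙ (2 *ₙ outerRank a c +ₙ signRank b)     ≤⟨ +-monoʳ-≤ (6 *ₙ ∣ b ∣) tail≤5 ⟩
  6 *ₙ ∣ b ∣ +ₙ 5                                      <⟨ +-monoʳ-< (6 *ₙ ∣ b ∣) (n<1+n 5) ⟩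
  6 *ₙ ∣ b ∣ +ₙ 6                                      ≡⟨ six-suc ∣ b ∣ ⟩
  6 *ₙ suc ∣ b ∣                                       ≤⟨ *-monoʳ-≤ 6 b<b' ⟩
  6 *ₙ ∣ b' ∣                                          ≤⟨ m≤m+n (6 *ₙ ∣ b' ∣) (2 *ₙ outerRank a' c' +ₙ signRank b') ⟩
  6 *ₙ ∣ b' ∣ +ₙ (2 *ₙ outerRank a' c' +ₙ signRank b') ∎
  where
  open ≤-Reasoning
  tail≤5 : 2 *ₙ outerRank a c +ₙ signRank b ≤ 5
  tail≤5 = +-mono-≤ (*-monoʳ-≤ 2 (outerRank≤2 a c)) (signRank≤1 b)
  six-suc : ∀ n → 6 *ₙ n +ₙ 6 ≡ 6 *ₙ suc n
  six-suc = ℕ-Solver.solve-∀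

outerRank-first : ∀ a c → ∣ c ∣ < ∣ a ∣ → outerRank a c ≡ 0
outerRank-first a c c<a with ∣ c ∣ <ᵇ ∣ a ∣ | <⇒<ᵇ c<a
... | true | _ = refl

outerRank-second : ∀ a c → ∣ c ∣ < ∣ a ∣ → outerRank c a ≡ 2
outerRank-second a c c<a with ∣ a ∣ <ᵇ ∣ c ∣ in a<ᵇc
... | true  = ⊥-elim (<-asym c<a (<ᵇ⇒< ∣ a ∣ ∣ c ∣ (subst T (sym a<ᵇc) tt)))
... | false with ∣ c ∣ <ᵇ ∣ a ∣ | <⇒<ᵇ c<a
...   | true | _ = refl

h-swap : ∀ a b c → ∣ c ∣ < ∣ a ∣ → h (vec a b c) < h (vec c b a)
h-swap a b c c<a rewrite outerRank-first a c c<a | outerRank-second a c c<a =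
  +-monoʳ-< (6 *ₙ ∣ b ∣) (m<n+m (signRank b) {4} z<s)

B-not-raising : ∀ a b c → ¬ Raises gB (vec a b c) → ∣ ν a b ∣ ≤ ∣ b ∣
B-not-raising a b c ¬r = ≮⇒≥ λ b<ν →
  ¬r (h-middle (vec a b c) (B · vec a b c) (subst (λ t → ∣ b ∣ < ∣ t ∣) (sym (B-middle a b c)) b<ν))

B⁻¹-not-raising : ∀ a b c → ¬ Raises gB⁻¹ (vec a b c) → ∣ ν (- a) b ∣ ≤ ∣ b ∣
B⁻¹-not-raising a b c ¬r = ≮⇒≥ λ b<ν →
  ¬r (h-middle (vec a b c) (B⁻¹ · vec a b c) (subst (λ t → ∣ b ∣ < ∣ t ∣) (sym (B⁻¹-middle a b c)) b<ν))

J-not-raising : ∀ a b c → ¬ Raises gJ (vec a b c) → ∣ a ∣ ≤ ∣ c ∣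
J-not-raising a b c ¬r = ≮⇒≥ λ c<a →
  ¬r (subst (λ t → h (vec a b c) < h t) (sym (J-· a b c)) (h-swap a b c c<a))

B-not-lowering : ∀ a b c → ¬ Lowers gB (vec a b c) → ∣ b ∣ ≤ ∣ ν a b ∣
B-not-lowering a b c ¬l = ≮⇒≥ λ ν<b →
  ¬l (h-middle (B · vec a b c) (vec a b c) (subst (λ t → ∣ t ∣ < ∣ b ∣) (sym (B-middle a b c)) ν<b))

B⁻¹-not-lowering : ∀ a b c → ¬ Lowers gB⁻¹ (vec a b c) → ∣ b ∣ ≤ ∣ ν (- a) b ∣
B⁻¹-not-lowering a b c ¬l = ≮⇒≥ λ ν<b →
  ¬l (h-middle (B⁻¹ · vec a b c) (vec a b c) (subst (λ t → ∣ t ∣ < ∣ b ∣) (sym (B⁻¹-middle a b c)) ν<b))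

J-not-lowering : ∀ a b c → ¬ Lowers gJ (vec a b c) → ∣ c ∣ ≤ ∣ a ∣
J-not-lowering a b c ¬l = ≮⇒≥ λ a<c →
  ¬l (subst (λ t → h t < h (vec a b c)) (sym (J-· a b c)) (h-swap c b a a<c))

square-abs : ∀ x → x * x ≡ + (∣ x ∣ *ₙ ∣ x ∣)
square-abs (+ n)    = sym (pos-* n n)
square-abs -[1+ n ] = refl

norm-equation : ∀ a b c → Q (vec a b c) ≡ + 2 → NormEq (∣ a ∣) (∣ b ∣) (∣ c ∣)
norm-equation a b c q = normEq (+-injective (begin
  + (A² +ₙ C²)                     ≡⟨ pos-+ A² C² ⟩
  + A² + + C²                      ≡⟨ cong₂ _+_ (square-abs a) (square-abs c) ⟨
  a * a + c * c                    ≡⟨ rearrange a b c ⟩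
  Q (vec a b c) + + 2 * (b * b)    ≡⟨ cong₂ (λ s t → s + + 2 * t) q (square-abs b) ⟩
  + 2 + + 2 * + β²                 ≡⟨ cong (_+_ (+ 2)) (pos-* 2 β²) ⟨
  + 2 + + (2 *ₙ β²)                ≡⟨ pos-+ 2 (2 *ₙ β²) ⟨
  + (2 +ₙ 2 *ₙ β²)                 ∎))
  where
  open ≡-Reasoning
  A² β² C² : ℕ
  A² = ∣ a ∣ *ₙ ∣ a ∣
  β² = ∣ b ∣ *ₙ ∣ b ∣
  C² = ∣ c ∣ *ₙ ∣ c ∣
  rearrange : ∀ a b c → a * a + c * c ≡ (c * c - + 2 * (b * b) + a * a) + + 2 * (b * b)
  rearrange = solve-∀

shift-not-raising : ∀ g a b c → g ≢ gJ → ¬ Raises g (vec a b c) → ∣ b ∣ ≤ ∣ a ∣ × (∣ b ∣ ≡ 0 → ∣ a ∣ ≡ 0)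
shift-not-raising gB   a b c _  ¬r = stall-bound a b (B-not-raising a b c ¬r)
shift-not-raising gB⁻¹ a b c _  ¬r = subst (λ n → ∣ b ∣ ≤ n × (∣ b ∣ ≡ 0 → n ≡ 0)) (∣-i∣≡∣i∣ a)
                                       (stall-bound (- a) b (B⁻¹-not-raising a b c ¬r))
shift-not-raising gJ   _ _ _ ne _  = ⊥-elim (ne refl)

no-stall-with-J : ∀ a b c → Q (vec a b c) ≡ + 2 → ∀ g → g ≢ gJ →
                  ¬ Raises g (vec a b c) → ¬ Raises gJ (vec a b c) → ⊥
no-stall-with-J a b c q g ne ¬r ¬rJ with shift-not-raising g a b c ne ¬r
... | β≤A , β≡0⇒A≡0 = no-double-stall (norm-equation a b c q) (J-not-raising a b c ¬rJ) β≤A β≡0⇒A≡0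

no-stall-B-B⁻¹ : ∀ a b c → Q (vec a b c) ≡ + 2 → ¬ Raises gB (vec a b c) → ¬ Raises gB⁻¹ (vec a b c) → ⊥
no-stall-B-B⁻¹ a b c q ¬r ¬r' =
  no-double-stall (norm-equation a b c q) (subst (_≤ ∣ c ∣) (sym a≡0) z≤n) (subst (_≤ ∣ a ∣) (sym b≡0) z≤n) (λ _ → a≡0)
  where
  b≡0 : ∣ b ∣ ≡ 0
  b≡0 = two-sided-stall a b (B-not-raising a b c ¬r) (B⁻¹-not-raising a b c ¬r')
  a≡0 : ∣ a ∣ ≡ 0
  a≡0 = proj₂ (stall-bound a b (B-not-raising a b c ¬r)) b≡0

no-two-stalls : ∀ a b c → Q (vec a b c) ≡ + 2 → ∀ g g' → g ≢ g' →
                ¬ Raises g (vec a b c) → ¬ Raises g' (vec a b c) → ⊥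
no-two-stalls a b c q gB   gB   ne _  _   = ne refl
no-two-stalls a b c q gB⁻¹ gB⁻¹ ne _  _   = ne refl
no-two-stalls a b c q gJ   gJ   ne _  _   = ne refl
no-two-stalls a b c q gB   gB⁻¹ _  ¬r ¬r' = no-stall-B-B⁻¹ a b c q ¬r ¬r'
no-two-stalls a b c q gB⁻¹ gB   _  ¬r ¬r' = no-stall-B-B⁻¹ a b c q ¬r' ¬r
no-two-stalls a b c q gB   gJ   ne ¬r ¬r' = no-stall-with-J a b c q gB ne ¬r ¬r'
no-two-stalls a b c q gB⁻¹ gJ   ne ¬r ¬r' = no-stall-with-J a b c q gB⁻¹ ne ¬r ¬r'
no-two-stalls a b c q gJ   gB   _  ¬r ¬r' = no-stall-with-J a b c q gB (λ ()) ¬r' ¬r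
no-two-stalls a b c q gJ   gB⁻¹ _  ¬r ¬r' = no-stall-with-J a b c q gB⁻¹ (λ ()) ¬r' ¬r

raises-one-of : ∀ y → Q y ≡ + 2 → ∀ g g' → g ≢ g' → Raises g y ⊎ Raises g' y
raises-one-of y@(a ∷ b ∷ c ∷ []) q g g' ne with h y <? h (⟦ g ⟧ · y) | h y <? h (⟦ g' ⟧ · y)
... | yes r  | _      = inj₁ r
... | no _   | yes r' = inj₂ r'
... | no ¬r  | no ¬r' = ⊥-elim (no-two-stalls a b c q g g' ne ¬r ¬r')

∀Gen? : {P : Gen → Set} → (∀ g → Dec (P g)) → Dec (∀ g → P g)
∀Gen? P? with P? gB | P? gB⁻¹ | P? gJ
... | yes p | yes q | yes r = yes λ { gB → p ; gB⁻¹ → q ; gJ → r }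
... | no ¬p | _     | _     = no λ all → ¬p (all gB)
... | yes _ | no ¬q | _     = no λ all → ¬q (all gB⁻¹)
... | yes _ | yes _ | no ¬r = no λ all → ¬r (all gJ)

lowers? : ∀ g y → Dec (Lowers g y)
lowers? g y = h (⟦ g ⟧ · y) <? h y

raises? : ∀ g y → Dec (Raises g y)
raises? g y = h y <? h (⟦ g ⟧ · y)

RootFacts : Vec3 → Set
RootFacts δ = Q δ ≡ + 2 × (∀ g → ¬ Lowers g δ) × (∀ g → Raises g δ ⊎ (g ≡ gJ × δ ∈ Special))

rootFacts : All RootFacts Δ₂
rootFacts = from-yes (all? rootFacts? Δ₂)
  where
  rootFacts? : ∀ δ → Dec (RootFacts δ)
  rootFacts? δ = (Q δ ≟ + 2) ×-dec ∀Gen? (λ g → ¬? (lowers? g δ))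
                   ×-dec ∀Gen? (λ g → raises? g δ ⊎-dec ((g ≟ᵍ gJ) ×-dec (δ ∈? Special)))

root-on-quadric : ∀ {δ} → δ ∈ Δ₂ → Q δ ≡ + 2
root-on-quadric m = proj₁ (All.lookup rootFacts m)

root-minimal : ∀ {δ} → δ ∈ Δ₂ → ∀ g → ¬ Lowers g δ
root-minimal m = proj₁ (proj₂ (All.lookup rootFacts m))

root-raises : ∀ {δ} → δ ∈ Δ₂ → ∀ g → Raises g δ ⊎ (g ≡ gJ × δ ∈ Special)
root-raises m = proj₂ (proj₂ (All.lookup rootFacts m))

special-fixed : ∀ {δ} → δ ∈ Special → J · δ ≡ δ
special-fixed (here refl)         = refl
special-fixed (there (here refl)) = refl

Abs≤1 Abs≤2 : List ℤ
Abs≤1 = + 0 ∷ + 1 ∷ - (+ 1) ∷ []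
Abs≤2 = + 0 ∷ + 1 ∷ - (+ 1) ∷ + 2 ∷ - (+ 2) ∷ []

abs≤1 : ∀ b → ∣ b ∣ ≤ 1 → b ∈ Abs≤1
abs≤1 (+ 0)            _        = here refl
abs≤1 (+ 1)            _        = there (here refl)
abs≤1 -[1+ 0 ]         _        = there (there (here refl))
abs≤1 (+ suc (suc n))  (s≤s ())
abs≤1 -[1+ suc n ]     (s≤s ())

abs≤2 : ∀ a → ∣ a ∣ ≤ 2 → a ∈ Abs≤2
abs≤2 (+ 0)                  _              = here refl
abs≤2 (+ 1)                  _              = there (here refl)
abs≤2 -[1+ 0 ]               _              = there (there (here refl))
abs≤2 (+ 2)                  _              = there (there (there (here refl)))
abs≤2 -[1+ 1 ]               _              = there (there (there (there (here refl))))
abs≤2 (+ suc (suc (suc n)))  (s≤s (s≤s ()))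
abs≤2 -[1+ suc (suc n) ]     (s≤s (s≤s ()))

MinimumIsRoot : Vec3 → Set
MinimumIsRoot y = Q y ≡ + 2 → (∀ g → ¬ Lowers g y) → y ∈ Δ₂

smallMinima : All (λ a → All (λ b → All (λ c → MinimumIsRoot (vec a b c)) Abs≤2) Abs≤1) Abs≤2
smallMinima = from-yes (all? (λ a → all? (λ b → all? (λ c → minimumIsRoot? (vec a b c)) Abs≤2) Abs≤1) Abs≤2)
  where
  minimumIsRoot? : ∀ y → Dec (MinimumIsRoot y)
  minimumIsRoot? y = (Q y ≟ + 2) →-dec (∀Gen? (λ g → ¬? (lowers? g y)) →-dec (y ∈? Δ₂))

-- A point of the quadric at which no generator lowers the height is a root: J not lowering
-- gives |c| ≤ |a|, B and B⁻¹ not lowering give |b| ≤ 1 (else descent-step applies), so the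
-- point lies in the box of smallMinima.
minimum-is-root : ∀ y → Q y ≡ + 2 → (∀ g → ¬ Lowers g y) → y ∈ Δ₂
minimum-is-root (a ∷ b ∷ c ∷ []) q minimal =
  All.lookup (All.lookup (All.lookup smallMinima (abs≤2 a A≤2)) (abs≤1 b β≤1)) (abs≤2 c (≤-trans C≤A A≤2)) q minimal
  where
  C≤A : ∣ c ∣ ≤ ∣ a ∣
  C≤A = J-not-lowering a b c (minimal gJ)
  middle-stays : ¬ (∣ ν a b ∣ < ∣ b ∣ ⊎ ∣ ν (- a) b ∣ < ∣ b ∣)
  middle-stays (inj₁ lt) = <⇒≱ lt (B-not-lowering a b c (minimal gB))
  middle-stays (inj₂ lt) = <⇒≱ lt (B⁻¹-not-lowering a b c (minimal gB⁻¹))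
  β≤1 : ∣ b ∣ ≤ 1
  β≤1 = ≮⇒≥ λ 1<β → let (β<A , A<2β) = between (norm-equation a b c q) C≤A 1<β in
                     middle-stays (descent-step a b β<A A<2β)
  A≤2 : ∣ a ∣ ≤ 2
  A≤2 = outer-bound (norm-equation a b c q) β≤1

-- Climbing: along a reduced word whose first step leaves a point where inv c lowers the
-- height, ping-pong forces every step to go up; so at the end point the inverse of the
-- last letter lowers the height.
climb : ∀ c r y → Q y ≡ + 2 → Lowers (inv c) y → ReducedAfter c r → Σ Gen λ d → Lowers d (act r y)
climb c []      y q lowers []        = inv c , lowers
climb c (g ∷ r) y q lowers (ne ∷ rr) with raises-one-of y q g (inv c) ne
... | inj₂ raises = ⊥-elim (<-asym lowers raises)
... | inj₁ raises = climb g r (⟦ g ⟧ · y) (trans (Q-invariant g y) q)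
                      (subst (λ t → h t < h (⟦ g ⟧ · y)) (sym (cancelˡ g y)) raises) rr

no-return : ∀ {g r δ δ'} → δ ∈ Δ₂ → δ' ∈ Δ₂ → Raises g δ → ReducedAfter g r → act r (⟦ g ⟧ · δ) ≢ δ'
no-return {g} {r} {δ} m m' raises rr e
  with climb g r (⟦ g ⟧ · δ) (trans (Q-invariant g δ) (root-on-quadric m))
             (subst (λ t → h t < h (⟦ g ⟧ · δ)) (sym (cancelˡ g δ)) raises) rr
... | d , lowers = root-minimal m' d (subst (Lowers d) e lowers)

after-J : ∀ {r δ δ'} → ReducedAfter gJ r → δ ∈ Δ₂ → δ' ∈ Δ₂ → act r δ ≡ δ' → r ≡ []
after-J []                         _ _  _ = refl
after-J {g ∷ r} (ne ∷ rr) m m' e with root-raises m g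
... | inj₁ raises     = ⊥-elim (no-return m m' raises rr e)
... | inj₂ (refl , _) = ⊥-elim (ne refl)

root-word : ∀ {r δ δ'} → Reduced r → δ ∈ Δ₂ → δ' ∈ Δ₂ → act r δ ≡ δ' →
            r ≡ [] ⊎ (r ≡ gJ ∷ [] × δ ∈ Special)
root-word []                _ _  _ = inj₁ refl
root-word {g ∷ r} (g ∷ rr) m m' e with root-raises m g
... | inj₁ raises      = ⊥-elim (no-return m m' raises rr e)
... | inj₂ (refl , sp) = inj₂ (cong (gJ ∷_) (after-J rr m m' (trans (cong (act r) (sym (special-fixed sp))) e)) , sp)

lowering? : ∀ y → Σ Gen (λ g → Lowers g y) ⊎ (∀ g → ¬ Lowers g y)
lowering? y with lowers? gB y | lowers? gB⁻¹ y | lowers? gJ y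
... | yes l | _     | _     = inj₁ (gB , l)
... | no _  | yes l | _     = inj₁ (gB⁻¹ , l)
... | no _  | no _  | yes l = inj₁ (gJ , l)
... | no ¬l | no ¬l' | no ¬l'' = inj₂ λ { gB → ¬l ; gB⁻¹ → ¬l' ; gJ → ¬l'' }

descend : ∀ y → Acc _<_ (h y) → Q y ≡ + 2 → Σ Vec3 λ δ → Σ Word λ w → δ ∈ Δ₂ × y ≡ act w δ
descend y (acc smaller) q with lowering? y
... | inj₂ minimal = y , [] , minimum-is-root y q minimal , refl
... | inj₁ (g , lowers) with descend (⟦ g ⟧ · y) (smaller lowers) (trans (Q-invariant g y) q)
...   | δ , w , m , e = δ , w ++ (inv g ∷ []) , m , (begin
  y                            ≡⟨ cancelˡ g y ⟨
  ⟦ inv g ⟧ · (⟦ g ⟧ · y)      ≡⟨ cong (⟦ inv g ⟧ ·_) e ⟩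
  ⟦ inv g ⟧ · act w δ          ≡⟨ act-++ w (inv g ∷ []) δ ⟨
  act (w ++ (inv g ∷ [])) δ    ∎)
  where open ≡-Reasoning

existence : ∀ y → Q y ≡ + 2 → Σ Vec3 λ δ → Σ Mat3 λ M → δ ∈ Δ₂ × InH M × y ≡ M · δ
existence y q with descend y (<-wellFounded (h y)) q
... | δ , w , m , e = δ , eval w , m , eval-InH w , trans e (sym (eval-· w δ))

quotient : Word → Word → Word
quotient w w' = reduce (w ++ inverse w')

quotient-act : ∀ w w' v → act (quotient w w') v ≡ act (inverse w') (act w v)
quotient-act w w' v = trans (reduce-act (w ++ inverse w') v) (act-++ w (inverse w') v)

quotient-reaches : ∀ w w' {δ δ'} → act w δ ≡ act w' δ' → act (quotient w w') δ ≡ δ'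
quotient-reaches w w' {δ} {δ'} e = begin
  act (quotient w w') δ          ≡⟨ quotient-act w w' δ ⟩
  act (inverse w') (act w δ)     ≡⟨ cong (act (inverse w')) e ⟩
  act (inverse w') (act w' δ')   ≡⟨ inverse-actˡ w' δ' ⟩
  δ'                             ∎
  where open ≡-Reasoning

transfer : ∀ w w' v t → act (quotient w w') v ≡ t → act w v ≡ act w' t
transfer w w' v t e = begin
  act w v                                ≡⟨ inverse-actʳ w' (act w v) ⟨
  act w' (act (inverse w') (act w v))    ≡⟨ cong (act w') (quotient-act w w' v) ⟨
  act w' (act (quotient w w') v)         ≡⟨ cong (act w') e ⟩
  act w' t                               ∎
  where open ≡-Reasoning

unique-words : ∀ w w' {δ δ'} → δ ∈ Δ₂ → δ' ∈ Δ₂ → act w δ ≡ act w' δ' →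
  δ' ≡ δ × ((∀ v → act w v ≡ act w' v) ⊎ (δ ∈ Special × (∀ v → act w v ≡ act w' (J · v))))
unique-words w w' {δ} m m' e with root-word (reduce-reduced (w ++ inverse w')) m m' (quotient-reaches w w' e)
... | inj₁ q≡[]       = trans (sym (quotient-reaches w w' e)) (cong (λ r → act r δ) q≡[])
                      , inj₁ λ v → transfer w w' v v (cong (λ r → act r v) q≡[])
... | inj₂ (q≡J , sp) = trans (sym (quotient-reaches w w' e)) (trans (cong (λ r → act r δ) q≡J) (special-fixed sp))
                      , inj₂ (sp , λ v → transfer w w' v (J · v) (cong (λ r → act r v) q≡J))

uniqueness : ∀ {M M' δ δ'} → InH M → InH M' → δ ∈ Δ₂ → δ' ∈ Δ₂ → M · δ ≡ M' · δ' →
             δ' ≡ δ × (M' ≡ M ⊎ (δ ∈ Special × M' ≡ M ⊗ J))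
uniqueness {δ = δ} {δ'} hM hM' m m' e with InH-eval hM | InH-eval hM'
... | w , refl | w' , refl with unique-words w w' m m' (trans (sym (eval-· w δ)) (trans e (eval-· w' δ')))
... | δ'≡δ , inj₁ same = δ'≡δ , inj₁ (·-injective (eval w') (eval w) λ v → begin
  eval w' · v     ≡⟨ eval-· w' v ⟩
  act w' v        ≡⟨ same v ⟨
  act w v         ≡⟨ eval-· w v ⟨
  eval w · v      ∎)
  where open ≡-Reasoning
... | δ'≡δ , inj₂ (sp , twisted) = δ'≡δ , inj₂ (sp , ·-injective (eval w') (eval w ⊗ J) λ v → begin
  eval w' · v            ≡⟨ eval-· w' v ⟩
  act w' v               ≡⟨ cong (act w') (cancelˡ gJ v) ⟨
  act w' (J · (J · v))   ≡⟨ twisted (J · v) ⟨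
  act w (J · v)          ≡⟨ eval-· w (J · v) ⟨
  eval w · (J · v)       ≡⟨ ⊗-· (eval w) J v ⟨
  (eval w ⊗ J) · v       ∎)
  where open ≡-Reasoning

theorem1p6 : (x₁ x₂ x₃ : ℤ) →
    x₃ * x₃ - + 2 * (x₂ * x₂) + x₁ * x₁ ≡ + 2 →
    Σ Vec3 λ δ → Σ Mat3 λ M →
      (δ ∈ Δ₂ × InH M × vec x₁ x₂ x₃ ≡ M · δ)
      × (∀ (δ' : Vec3) (M' : Mat3) → δ' ∈ Δ₂ → InH M' → vec x₁ x₂ x₃ ≡ M' · δ' → δ' ≡ δ)
      × (δ ∉ Special → ∀ (M' : Mat3) → InH M' → vec x₁ x₂ x₃ ≡ M' · δ → M' ≡ M)
      × (δ ∈ Special → ∀ (M' : Mat3) → InH M' → vec x₁ x₂ x₃ ≡ M' · δ → (M' ≡ M ⊎ M' ≡ M ⊗ J))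
theorem1p6 x₁ x₂ x₃ q with existence (vec x₁ x₂ x₃) q
... | δ , M , m , hM , e = δ , M , (m , hM , e) , same-root , unique-off-special , unique-up-to-J
  where
  compare : ∀ {δ' M'} → δ' ∈ Δ₂ → InH M' → vec x₁ x₂ x₃ ≡ M' · δ' →
            δ' ≡ δ × (M' ≡ M ⊎ (δ ∈ Special × M' ≡ M ⊗ J))
  compare m' hM' e' = uniqueness hM hM' m m' (trans (sym e) e')
  same-root : ∀ δ' M' → δ' ∈ Δ₂ → InH M' → vec x₁ x₂ x₃ ≡ M' · δ' → δ' ≡ δ
  same-root _ _ m' hM' e' = proj₁ (compare m' hM' e')
  unique-off-special : δ ∉ Special → ∀ M' → InH M' → vec x₁ x₂ x₃ ≡ M' · δ → M' ≡ M
  unique-off-special ¬sp _ hM' e' with proj₂ (compare m hM' e')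
  ... | inj₁ M'≡M     = M'≡M
  ... | inj₂ (sp , _) = ⊥-elim (¬sp sp)
  unique-up-to-J : δ ∈ Special → ∀ M' → InH M' → vec x₁ x₂ x₃ ≡ M' · δ → M' ≡ M ⊎ M' ≡ M ⊗ J
  unique-up-to-J _ _ hM' e' with proj₂ (compare m hM' e')
  ... | inj₁ M'≡M        = inj₁ M'≡M
  ... | inj₂ (_ , M'≡MJ) = inj₂ M'≡MJ
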